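{- Let $q\ge 2$ be an integer and let $A$ and $r$ be positive integers with $q^r\ge A$. Then the function $g(n)=s_q(An)$ on the non-negative integers is $q$-quasi-additive with parameter $r$, i.e. $g(q^{k+r}a+b)=g(a)+g(b)$ for all integers $k\ge0$, $a\ge0$ and $0\le b<q^k$.
   Context: For an integer $q\ge2$, $s_q(m)$ denotes the sum of the digits of the base-$q$ expansion of the non-negative integer $m$. A function $f$ on the non-negative integers is called $q$-quasi-additive (with parameter $r\ge0$) if $f(q^{k+r}a+b)=f(a)+f(b)$ for all non-negative integers $k,a$ and all integers $0\le b<q^k$. -}

module Defs where

open import Data.Nat using (ℕ; zero; suc; _+_; _*_; _^_; _<_; _≤_; s≤s)
open import Data.Nat.DivMod using (_/_; _%_)

digitSumFuel : ℕ → ℕ → ℕ → ℕ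
digitSumFuel p zero    m = 0
digitSumFuel p (suc f) m = m % suc (suc p) + digitSumFuel p f (m / suc (suc p))

-- s_q(m) for base q = 2 + p (i.e. q ≥ 2): sum of base-q digits of m.
-- Fuel m suffices: after j steps the remaining value is ≤ m / 2^j, which is 0
-- once j ≥ m (and extra steps on 0 contribute 0).
s : (q : ℕ) → 2 ≤ q → ℕ → ℕ
s (suc (suc p)) _ m = digitSumFuel p m m
s (suc zero) (s≤s ()) m
s zero () m

QuasiAdditive : (q r : ℕ) → (ℕ → ℕ) → Set
QuasiAdditive q r f =
  ∀ (k a b : ℕ) → b < q ^ k → f (q ^ (k + r) * a + b) ≡ f a + f b
  where open import Relation.Binary.PropositionalEquality using (_≡_)

{-# OPTIONS --safe #-}
module Submission where

open import Defs
open import Data.Nat using (ℕ; zero; suc; _+_; _*_; _^_; _≤_; _<_; z≤n; s≤s; NonZero; >-nonZero)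
open import Data.Nat.Properties
open import Data.Nat.DivMod
open import Data.Nat.Divisibility using (n∣m*n)
open import Relation.Binary.PropositionalEquality
open import Algebra.Properties.CommutativeSemigroup *-commutativeSemigroup using () renaming (x∙yz≈y∙xz to x*yz≡y*xz)
open import Algebra.Properties.CommutativeSemigroup +-commutativeSemigroup using () renaming (x∙yz≈y∙xz to x+yz≡y+xz)

-- Base-q digits concatenate: if b < q^k then the digits of q^k·a + b are those
-- of a followed by those of b (padded to length k), so s_q is additive on them.
-- For g(n) = s_q(An) it remains to note that A(q^(k+r)a + b) = q^(k+r)(Aa) + Ab
-- with Ab < A q^k ≤ q^(k+r).

[m+kn]/n≡m/n+k : ∀ m k n .{{_ : NonZero n}} → (m + k * n) / n ≡ m / n + k
[m+kn]/n≡m/n+k m k n = trans (+-distrib-/-∣ʳ m (n∣m*n k)) (cong (m / n +_) (m*n/n≡m k n))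

A≤qʳ∧b<qᵏ⇒A*b<qᵏ⁺ʳ : ∀ {A b q k r} → 0 < A → A ≤ q ^ r → b < q ^ k → A * b < q ^ (k + r)
A≤qʳ∧b<qᵏ⇒A*b<qᵏ⁺ʳ {A} {b} {q} {k} {r} 0<A A≤qʳ b<qᵏ = begin-strict
  A * b         <⟨ *-monoʳ-< A ⦃ >-nonZero 0<A ⦄ b<qᵏ ⟩
  A * q ^ k     ≤⟨ *-monoˡ-≤ (q ^ k) A≤qʳ ⟩
  q ^ r * q ^ k ≡⟨ ^-distribˡ-+-* q r k ⟨
  q ^ (r + k)   ≡⟨ cong (q ^_) (+-comm r k) ⟩
  q ^ (k + r)   ∎
  where open ≤-Reasoning

module Base (p : ℕ) where

  q : ℕ
  q = suc (suc p)

  digitSum : ℕ → ℕ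
  digitSum = s q (s≤s (s≤s z≤n))

  digitSumFuel-0 : ∀ f → digitSumFuel p f 0 ≡ 0
  digitSumFuel-0 zero    = refl
  digitSumFuel-0 (suc f) = digitSumFuel-0 f

  m≤1+f⇒m/q≤f : ∀ m f → m ≤ suc f → m / q ≤ f
  m≤1+f⇒m/q≤f zero    f _    = z≤n
  m≤1+f⇒m/q≤f (suc m) f m≤1+f = ≤-pred (≤-trans (m/n<m (suc m) q (s≤s (s≤s z≤n))) m≤1+f)

  digitSumFuel-irrelevant : ∀ f g m → m ≤ f → m ≤ g → digitSumFuel p f m ≡ digitSumFuel p g m
  digitSumFuel-irrelevant zero    g       .zero z≤n _   = sym (digitSumFuel-0 g)
  digitSumFuel-irrelevant (suc f) zero    .zero _   z≤n = digitSumFuel-0 (suc f)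
  digitSumFuel-irrelevant (suc f) (suc g) m     m≤f m≤g = cong (m % q +_)
    (digitSumFuel-irrelevant f g (m / q) (m≤1+f⇒m/q≤f m f m≤f) (m≤1+f⇒m/q≤f m g m≤g))

  digitSum-unfold : ∀ m → digitSum m ≡ m % q + digitSum (m / q)
  digitSum-unfold zero    = refl
  digitSum-unfold (suc m) = cong (suc m % q +_)
    (digitSumFuel-irrelevant m (suc m / q) (suc m / q) (m≤1+f⇒m/q≤f (suc m) m ≤-refl) ≤-refl)

  digitSum-concat : ∀ j x y → y < q ^ j → digitSum (q ^ j * x + y) ≡ digitSum x + digitSum y
  digitSum-concat zero    x zero    _        = begin
    digitSum (1 * x + 0) ≡⟨ cong digitSum (trans (+-identityʳ (1 * x)) (*-identityˡ x)) ⟩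
    digitSum x           ≡⟨ +-identityʳ (digitSum x) ⟨
    digitSum x + 0       ∎
    where open ≡-Reasoning
  digitSum-concat zero    x (suc y) (s≤s ())
  digitSum-concat (suc j) x y       y<q¹⁺ʲ = begin
    digitSum n                           ≡⟨ digitSum-unfold n ⟩
    n % q + digitSum (n / q)             ≡⟨ cong₂ (λ u v → u + digitSum v) n%q≡y%q n/q≡qʲx+y/q ⟩
    y % q + digitSum (q ^ j * x + y / q) ≡⟨ cong (y % q +_) (digitSum-concat j x (y / q) y/q<qʲ) ⟩
    y % q + (digitSum x + digitSum (y / q)) ≡⟨ x+yz≡y+xz (y % q) (digitSum x) _ ⟩
    digitSum x + (y % q + digitSum (y / q)) ≡⟨ cong (digitSum x +_) (digitSum-unfold y) ⟨
    digitSum x + digitSum y              ∎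
    where
    open ≡-Reasoning
    n = q ^ suc j * x + y

    n≡y+qʲx*q : n ≡ y + q ^ j * x * q
    n≡y+qʲx*q = trans (+-comm (q * q ^ j * x) y)
      (cong (y +_) (trans (*-assoc q (q ^ j) x) (*-comm q (q ^ j * x))))

    n%q≡y%q : n % q ≡ y % q
    n%q≡y%q = trans (cong (_% q) n≡y+qʲx*q) ([m+kn]%n≡m%n y (q ^ j * x) q)

    n/q≡qʲx+y/q : n / q ≡ q ^ j * x + y / q
    n/q≡qʲx+y/q = trans (/-congˡ n≡y+qʲx*q)
      (trans ([m+kn]/n≡m/n+k y (q ^ j * x) q) (+-comm (y / q) (q ^ j * x)))

    y/q<qʲ : y / q < q ^ j
    y/q<qʲ = m<n*o⇒m/o<n (subst (y <_) (*-comm q (q ^ j)) y<q¹⁺ʲ)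

lemma1 : (q : ℕ) (hq : 2 ≤ q) (A r : ℕ) → 0 < A → 0 < r → A ≤ q ^ r →
    QuasiAdditive q r (λ n → s q hq (A * n))
lemma1 (suc (suc p)) (s≤s (s≤s z≤n)) A r 0<A _ A≤qʳ k a b b<qᵏ = begin
  digitSum (A * (qᵏ⁺ʳ * a + b))        ≡⟨ cong digitSum (*-distribˡ-+ A (qᵏ⁺ʳ * a) b) ⟩
  digitSum (A * (qᵏ⁺ʳ * a) + A * b)    ≡⟨ cong (λ c → digitSum (c + A * b)) (x*yz≡y*xz A qᵏ⁺ʳ a) ⟩
  digitSum (qᵏ⁺ʳ * (A * a) + A * b)    ≡⟨ digitSum-concat (k + r) (A * a) (A * b) (A≤qʳ∧b<qᵏ⇒A*b<qᵏ⁺ʳ {q = q} {k} {r} 0<A A≤qʳ b<qᵏ) ⟩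
  digitSum (A * a) + digitSum (A * b)  ∎
  where
  open Base p
  open ≡-Reasoning
  qᵏ⁺ʳ = q ^ (k + r)
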